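{- Let $\mathcal{T}$ be any response tree (as defined in the context). Then $\mathrm{ON}(\mathcal{T}) \le \left(1 + \frac{2}{k-2}\right)\mathrm{OPT}(\mathcal{T})$.
   Context: Setting: metric space $\mathcal{M}$ with distance $d$; server sites $s_1,\dots,s_n$ and requests $r_1,\dots,r_n$ arriving in this order. Each site has one server for the optimal solution and $k \ge 3$ servers for the online algorithm. The optimal solution assigns $r_i$ to $s_i$ (adversary edge $(r_i,s_i)$), and $\mathrm{GREEDY}$ (which assigns each arriving request to a nearest site with an unused server) assigns $r_i$ to $s_{\sigma(i)}$ (online edge $(s_{\sigma(i)}, r_i)$). The response graph $\mathcal{G}$ has vertex set the sites and requests, and edge set all adversary and online edges, each weighted by the distance between its endpoints. The response graph is decomposed into response trees by repeatedly taking, in a remaining connected component, the most recent request $r_i$, deleting its online edge $(s_{\sigma(i)}, r_i)$, forming the tree rooted at $r_i$ consisting of all vertices reachable from $r_i$ in the resulting component by paths having no internal server site that had an unused online server at the arrival time of $r_i$, and removing its edges and request vertices. Every edge of $\mathcal{G}$ lies in exactly one response tree or is the online edge of the root of exactly one response tree (not both). Each response tree $\mathcal{T}$ rooted at a request $r_i$ is a subgraph of $\mathcal{G}$ with: every request $r_j \in \mathcal{T}$ has exactly one child, $s_j$; every leaf is a site $s_j$ with parent $r_j$; every non-leaf site has exactly $k$ children, joined to it by its $k$ online edges; for every request $r_j \in \mathcal{T}$ and leaf $s_q$, $\mathrm{GREEDY}$ had an unused server at $s_q$ when $r_j$ arrived. $\mathrm{OPT}(\mathcal{T}) = \sum_{(r_j,s_j)\in\mathcal{T}}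 d(r_j,s_j)$ is the total weight of adversary edges in $\mathcal{T}$, and $\mathrm{ON}(\mathcal{T}) = \sum_{r_j \in \mathcal{T}} d(s_{\sigma(j)}, r_j)$ is the total weight of the online edges of all requests in $\mathcal{T}$ (including the root's online edge, which is not itself in $\mathcal{T}$). -}

module Defs where

open import Level using (Level; _⊔_) renaming (suc to lsuc)
open import Data.Nat as ℕ using (ℕ; zero; suc)
open import Data.Fin as Fin using (Fin)
open import Data.Fin.Properties using () renaming (_≟_ to _≟ᶠ_)
open import Data.List using (List; []; _∷_; _++_; length; filter; concatMap; map; foldr)
open import Data.List.Membership.Propositional using (_∈_)
open import Data.Product using (_×_)
open import Relation.Nullary.Decidable using (_×-dec_)
open import Relation.Binary using (Rel; IsTotalOrder)
open import Relation.Binary.PropositionalEquality using (_≡_)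
open import Algebra.Bundles using (CommutativeRing)
open import Data.List using () renaming (allFin to allFinL)

-- Totally ordered commutative ring: the codomain of the distance
-- function (the real numbers are an instance).

record OrderedCommRing (c ℓ₁ ℓ₂ : Level) : Set (lsuc (c ⊔ ℓ₁ ⊔ ℓ₂)) where
  field
    commutativeRing : CommutativeRing c ℓ₁
  open CommutativeRing commutativeRing public
  infix 4 _≤_
  field
    _≤_          : Rel Carrier ℓ₂
    isTotalOrder : IsTotalOrder _≈_ _≤_
    +-mono-≤     : ∀ {x y} z → x ≤ y → (x + z) ≤ (y + z)
    *-nonneg     : ∀ {x y} → 0# ≤ x → 0# ≤ y → 0# ≤ (x * y)

  infixr 8 _·_
  _·_ : ℕ → Carrier → Carrier
  zero  · x = 0#
  suc n · x = x + n · x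

  Σ-list : List Carrier → Carrier
  Σ-list = foldr _+_ 0#

record MetricSpace {c ℓ₁ ℓ₂} (R : OrderedCommRing c ℓ₁ ℓ₂) (a : Level)
       : Set (lsuc a ⊔ c ⊔ ℓ₁ ⊔ ℓ₂) where
  open OrderedCommRing R
  field
    Point    : Set a
    d        : Point → Point → Carrier
    d-nonneg : ∀ x y → 0# ≤ d x y
    d-zero⇒≡ : ∀ x y → d x y ≈ 0# → x ≡ y
    d-refl   : ∀ x → d x x ≈ 0#
    d-sym    : ∀ x y → d x y ≈ d y x
    d-tri    : ∀ x y z → d x z ≤ (d x y + d y z)

-- Online assignment σ : request index ↦ site index.
-- used k σ j i = number of earlier requests r_{i'} (i' < i) assigned to s_j.

used : ∀ {n} → (Fin n → Fin n) → Fin n → Fin n → ℕ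
used {n} σ j i = length (filter (λ i' → (i' Fin.<? i) ×-dec (σ i' ≟ᶠ j)) (allFinL n))

Unused : ∀ {n} → ℕ → (Fin n → Fin n) → Fin n → Fin n → Set
Unused k σ j i = used σ j i ℕ.< k

record IsGreedy {c ℓ₁ ℓ₂ a} (R : OrderedCommRing c ℓ₁ ℓ₂) (M : MetricSpace R a)
                (k : ℕ) {n : ℕ} (s r : Fin n → MetricSpace.Point M)
                (σ : Fin n → Fin n) : Set (ℓ₂) where
  open OrderedCommRing R
  open MetricSpace M
  field
    capacity : ∀ i → Unused k σ (σ i) i
    nearest  : ∀ i j → Unused k σ j i → d (s (σ i)) (r i) ≤ d (s j) (r i)

-- ReqTree j : subtree rooted at request r_j,
-- whose unique child is site s_j (adversary edge (r_j, s_j)).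
-- SiteTree j : subtree rooted at site s_j; either a leaf, or a site with
-- exactly k children r_{ch t} (t : Fin k) joined by online edges
-- (σ (ch t) ≡ j).

mutual
  data ReqTree {n : ℕ} (k : ℕ) (σ : Fin n → Fin n) : Fin n → Set where
    req : ∀ {j} → SiteTree k σ j → ReqTree k σ j

  data SiteTree {n : ℕ} (k : ℕ) (σ : Fin n → Fin n) : Fin n → Set where
    leaf   : ∀ {j} → SiteTree k σ j
    branch : ∀ {j} (ch : Fin k → Fin n) → (∀ t → σ (ch t) ≡ j)
             → ((t : Fin k) → ReqTree k σ (ch t)) → SiteTree k σ j

mutual
  reqs : ∀ {n k σ j} → ReqTree {n} k σ j → List (Fin n)
  reqs {j = j} (req st) = j ∷ reqsS st

  reqsS : ∀ {n k σ j} → SiteTree {n} k σ j → List (Fin n)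
  reqsS leaf = []
  reqsS {k = k} (branch ch _ ts) = concatMap (λ t → reqs (ts t)) (allFinL k)

mutual
  leaves : ∀ {n k σ j} → ReqTree {n} k σ j → List (Fin n)
  leaves (req st) = leavesS st

  leavesS : ∀ {n k σ j} → SiteTree {n} k σ j → List (Fin n)
  leavesS {j = j} leaf = j ∷ []
  leavesS {k = k} (branch ch _ ts) = concatMap (λ t → leaves (ts t)) (allFinL k)

module _ {c ℓ₁ ℓ₂ a} (R : OrderedCommRing c ℓ₁ ℓ₂) (M : MetricSpace R a) where
  open OrderedCommRing R
  open MetricSpace M

  OPT : ∀ {n k σ j} (s r : Fin n → Point) → ReqTree {n} k σ j → Carrier
  OPT s r T = Σ-list (map (λ m → d (r m) (s m)) (reqs T))

  ON : ∀ {n k} {σ : Fin n → Fin n} {j} (s r : Fin n → Point) → ReqTree {n} k σ j → Carrier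
  ON {σ = σ} s r T = Σ-list (map (λ m → d (s (σ m)) (r m)) (reqs T))

-- For a subtree rooted at request r_j we find a leaf s_q and a
-- walk length X ≥ d(s_q, r_j) with (k−2)·ON⁻ + k·X ≤ k·OPT, where ON⁻ omits the root's
-- online edge.  At a site s_j with children r_c (one per server), greedy served r_c while
-- the leaf s_{q_c} of its subtree was free, so d(s_j, r_c) ≤ d(s_{q_c}, r_c) ≤ X_c.  The
-- walk is extended from the child with the least X_c; it pays at most 2·X_c, and
-- k·2·X_min ≤ 2·Σ X_c is covered by the two spare units of k = (k−2) + 2.  At the root,
-- greedy again bounds the root's online edge by X.
module Submission where

open import Defs
open import Data.Nat using (ℕ; _∸_) renaming (_≤_ to _≤ℕ_)
open import Data.Fin using (Fin) renaming (_≤_ to _≤ᶠ_)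
open import Data.List.Membership.Propositional using (_∈_)
open import Data.List.Relation.Unary.Unique.Propositional using (Unique)

open import Level using (_⊔_)
open import Data.Nat using (zero; suc; z≤n; s≤s)
open import Data.Nat.Properties using (m≤n+m)
import Data.Fin as Fin
open import Data.List using (List; []; _∷_; _++_; map; concatMap; length; tabulate; allFin)
open import Data.List.Properties using (map-++; length-tabulate)
open import Data.List.Relation.Unary.Any using (here; there)
open import Data.List.Membership.Propositional using (lose)
open import Data.List.Membership.Propositional.Properties using (∈-concatMap⁺; ∈-allFin)
open import Data.Product using (∃; _,_; proj₁; proj₂)
open import Data.Sum using (inj₁; inj₂)
open import Relation.Binary using (IsTotalOrder)
import Relation.Binary.PropositionalEquality as ≡
import Data.Vec as Vec

∈-concatMap-allFin : ∀ {k} {B : Set} (f : Fin k → List B) t {x} → x ∈ f t → x ∈ concatMap f (allFin k)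
∈-concatMap-allFin f t x∈ = ∈-concatMap⁺ f (lose (∈-allFin t) x∈)

module OrderedCommRingProperties {c ℓ₁ ℓ₂} (R : OrderedCommRing c ℓ₁ ℓ₂) where
  open OrderedCommRing R
  open IsTotalOrder isTotalOrder public
    using (isPreorder; total) renaming (refl to ≤-refl; trans to ≤-trans; reflexive to ≤-reflexive)
  open import Relation.Binary.Reasoning.Base.Double isPreorder
  open import Algebra.Properties.CommutativeSemigroup +-commutativeSemigroup using (interchange)
  open import Algebra.Solver.CommutativeMonoid +-commutativeMonoid using (prove; var; _⊕_)

  +-mono₂-≤ : ∀ {x y u v} → x ≤ y → u ≤ v → x + u ≤ y + v
  +-mono₂-≤ {x} {y} {u} {v} x≤y u≤v = begin
    x + u ≲⟨ +-mono-≤ u x≤y ⟩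
    y + u ≈⟨ +-comm y u ⟩
    u + y ≲⟨ +-mono-≤ y u≤v ⟩
    v + y ≈⟨ +-comm v y ⟩
    y + v ∎

  +-monoʳ-≤ : ∀ z {x y} → x ≤ y → z + x ≤ z + y
  +-monoʳ-≤ z = +-mono₂-≤ ≤-refl

  ·-cong : ∀ n {x y} → x ≈ y → n · x ≈ n · y
  ·-cong zero    _   = refl
  ·-cong (suc n) x≈y = +-cong x≈y (·-cong n x≈y)

  ·-monoʳ-≤ : ∀ n {x y} → x ≤ y → n · x ≤ n · y
  ·-monoʳ-≤ zero    _   = ≤-refl
  ·-monoʳ-≤ (suc n) x≤y = +-mono₂-≤ x≤y (·-monoʳ-≤ n x≤y)

  ·-nonneg : ∀ n {x} → 0# ≤ x → 0# ≤ n · x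
  ·-nonneg zero    _    = ≤-refl
  ·-nonneg (suc n) {x} 0≤x = begin
    0#         ≈⟨ +-identityˡ 0# ⟨
    0# + 0#    ≲⟨ +-mono₂-≤ 0≤x (·-nonneg n 0≤x) ⟩
    x + n · x  ∎

  ·-monoˡ-≤ : ∀ {m n x} → m ≤ℕ n → 0# ≤ x → m · x ≤ n · x
  ·-monoˡ-≤ {n = n} {x} z≤n 0≤x = ·-nonneg n 0≤x
  ·-monoˡ-≤ (s≤s m≤n) 0≤x = +-monoʳ-≤ _ (·-monoˡ-≤ m≤n 0≤x)

  ·-zeroʳ : ∀ n → n · 0# ≈ 0#
  ·-zeroʳ zero    = refl
  ·-zeroʳ (suc n) = trans (+-identityˡ _) (·-zeroʳ n)

  ·-distribˡ : ∀ n {x y} → n · (x + y) ≈ n · x + n · y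
  ·-distribˡ zero            = sym (+-identityˡ 0#)
  ·-distribˡ (suc n) {x} {y} = trans (+-congˡ (·-distribˡ n)) (interchange x y (n · x) (n · y))

  Σ-list-++ : ∀ xs ys → Σ-list (xs ++ ys) ≈ Σ-list xs + Σ-list ys
  Σ-list-++ []       ys = sym (+-identityˡ _)
  Σ-list-++ (x ∷ xs) ys = trans (+-congˡ (Σ-list-++ xs ys)) (sym (+-assoc x _ _))

  sumBy : ∀ {A : Set} → (A → Carrier) → List A → Carrier
  sumBy f xs = Σ-list (map f xs)

  module _ {A : Set} where

    sumBy-concatMap : ∀ {B : Set} (f : B → Carrier) (g : A → List B) xs →
                      sumBy f (concatMap g xs) ≈ sumBy (λ x → sumBy f (g x)) xs
    sumBy-concatMap f g []       = refl
    sumBy-concatMap f g (x ∷ xs) = begin-equality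
      Σ-list (map f (g x ++ concatMap g xs))
        ≡⟨ ≡.cong Σ-list (map-++ f (g x) (concatMap g xs)) ⟩
      Σ-list (map f (g x) ++ map f (concatMap g xs))
        ≈⟨ Σ-list-++ (map f (g x)) _ ⟩
      sumBy f (g x) + sumBy f (concatMap g xs)
        ≈⟨ +-congˡ (sumBy-concatMap f g xs) ⟩
      sumBy f (g x) + sumBy (λ y → sumBy f (g y)) xs ∎

    sumBy-cong : ∀ {f g : A → Carrier} → (∀ x → f x ≈ g x) → ∀ xs → sumBy f xs ≈ sumBy g xs
    sumBy-cong f≈g []       = refl
    sumBy-cong f≈g (x ∷ xs) = +-cong (f≈g x) (sumBy-cong f≈g xs)

    sumBy-mono-≤ : ∀ {f g : A → Carrier} → (∀ x → f x ≤ g x) → ∀ xs → sumBy f xs ≤ sumBy g xs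
    sumBy-mono-≤ f≤g []       = ≤-refl
    sumBy-mono-≤ f≤g (x ∷ xs) = +-mono₂-≤ (f≤g x) (sumBy-mono-≤ f≤g xs)

    sumBy-+ : ∀ (f g : A → Carrier) xs → sumBy (λ x → f x + g x) xs ≈ sumBy f xs + sumBy g xs
    sumBy-+ f g []       = sym (+-identityˡ 0#)
    sumBy-+ f g (x ∷ xs) = trans (+-congˡ (sumBy-+ f g xs)) (interchange (f x) (g x) _ _)

    ·-sumBy : ∀ n (f : A → Carrier) xs → n · sumBy f xs ≈ sumBy (λ x → n · f x) xs
    ·-sumBy n f []       = ·-zeroʳ n
    ·-sumBy n f (x ∷ xs) = trans (·-distribˡ n) (+-congˡ (·-sumBy n f xs))

    ∃-length·≤sumBy : ∀ (f : A → Carrier) x xs → ∃ λ y → length (x ∷ xs) · f y ≤ sumBy f (x ∷ xs)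
    ∃-length·≤sumBy f x []       = x , ≤-refl
    ∃-length·≤sumBy f x (z ∷ xs) with ∃-length·≤sumBy f z xs
    ... | y , bound with total (f x) (f y)
    ...   | inj₁ fx≤fy = x , +-monoʳ-≤ (f x) (≤-trans (·-monoʳ-≤ (length (z ∷ xs)) fx≤fy) bound)
    ...   | inj₂ fy≤fx = y , +-mono₂-≤ fy≤fx bound

    -- A node with k = m + 2 children: `e` are the children's online edges, `O` and `P`
    -- their subtrees' ON⁻ and OPT, `D` their walk lengths, and `a` the node's adversary edge.
    branch-budget :
      ∀ m (xs : List A) (e O D P : A → Carrier) (a : Carrier) (t : A) →
      let k = suc (suc m) in
      (∀ x → e x ≤ D x) → k · D t ≤ sumBy D xs →
      (∀ x → m · O x + k · D x ≤ k · P x) →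
      m · sumBy (λ x → e x + O x) xs + k · (a + (e t + D t)) ≤ k · (a + sumBy P xs)
    branch-budget m xs e O D P a t e≤D Dt≤ sub = begin
      m · sumBy (λ x → e x + O x) xs + k · (a + (e t + D t))
        ≈⟨ +-congʳ (·-cong m (sumBy-+ e O xs)) ⟩
      m · (SE + SO) + k · (a + (e t + D t))
        ≲⟨ +-mono₂-≤ (·-monoʳ-≤ m (+-mono-≤ SO (sumBy-mono-≤ e≤D xs)))
                     (·-monoʳ-≤ k (+-monoʳ-≤ a (+-mono-≤ (D t) (e≤D t)))) ⟩
      m · (SD + SO) + k · (a + (D t + D t))
        ≈⟨ +-cong (·-distribˡ m) (trans (·-distribˡ k) (+-congˡ (·-distribˡ k))) ⟩
      (m · SD + m · SO) + (k · a + (k · D t + k · D t))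
        ≲⟨ +-monoʳ-≤ _ (+-monoʳ-≤ _ (+-mono₂-≤ Dt≤ Dt≤)) ⟩
      (m · SD + m · SO) + (k · a + (SD + SD))
        ≈⟨ rearrange (m · SD) (m · SO) (k · a) SD ⟩
      k · a + (m · SO + k · SD)
        ≈⟨ +-congˡ (trans (+-cong (·-sumBy m O xs) (·-sumBy k D xs)) (sym (sumBy-+ _ _ xs))) ⟩
      k · a + sumBy (λ x → m · O x + k · D x) xs
        ≲⟨ +-monoʳ-≤ _ (sumBy-mono-≤ sub xs) ⟩
      k · a + sumBy (λ x → k · P x) xs
        ≈⟨ +-congˡ (·-sumBy k P xs) ⟨
      k · a + k · sumBy P xs
        ≈⟨ ·-distribˡ k ⟨
      k · (a + sumBy P xs) ∎
      where
      k = suc (suc m)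
      SE SO SD : Carrier
      SE = sumBy e xs
      SO = sumBy O xs
      SD = sumBy D xs
      -- `k · SD` unfolds to `SD + (SD + m · SD)`.
      rearrange : ∀ w x y z → (w + x) + (y + (z + z)) ≈ y + (x + (z + (z + w)))
      rearrange w x y z = prove 4 ((W ⊕ X) ⊕ (Y ⊕ (Z ⊕ Z))) (Y ⊕ (X ⊕ (Z ⊕ (Z ⊕ W))))
                            (w Vec.∷ x Vec.∷ y Vec.∷ z Vec.∷ Vec.[])
        where
        W = var Fin.zero
        X = var (Fin.suc Fin.zero)
        Y = var (Fin.suc (Fin.suc Fin.zero))
        Z = var (Fin.suc (Fin.suc (Fin.suc Fin.zero)))

  ∃-·≤sumBy-allFin : ∀ n (f : Fin (suc n) → Carrier) → ∃ λ t → suc n · f t ≤ sumBy f (allFin (suc n))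
  ∃-·≤sumBy-allFin n f with ∃-length·≤sumBy f Fin.zero (tabulate Fin.suc)
  ... | t , bound = t , ≡.subst (λ l → suc l · f t ≤ sumBy f (allFin (suc n)))
                                (length-tabulate {n = n} Fin.suc) bound

module MetricSpaceProperties {c ℓ₁ ℓ₂ a} (R : OrderedCommRing c ℓ₁ ℓ₂) (M : MetricSpace R a) where
  open OrderedCommRing R
  open MetricSpace M
  open OrderedCommRingProperties R
  open import Relation.Binary.Reasoning.Base.Double isPreorder

  d-detour : ∀ {x y z w D} → d x y ≤ D → d x w ≤ d w z + (d z y + D)
  d-detour {x} {y} {z} {w} {D} dxy≤D = begin
    d x w                       ≲⟨ d-tri x z w ⟩
    d x z + d z w               ≲⟨ +-mono-≤ (d z w) (d-tri x y z) ⟩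
    (d x y + d y z) + d z w     ≲⟨ +-mono-≤ (d z w) (+-mono-≤ (d y z) dxy≤D) ⟩
    (D + d y z) + d z w         ≈⟨ +-cong (+-cong refl (d-sym y z)) (d-sym z w) ⟩
    (D + d z y) + d w z         ≈⟨ +-comm _ _ ⟩
    d w z + (D + d z y)         ≈⟨ +-congˡ (+-comm D (d z y)) ⟩
    d w z + (d z y + D)         ∎

module ResponseTreeBound {c ℓ₁ ℓ₂ a} (R : OrderedCommRing c ℓ₁ ℓ₂) (M : MetricSpace R a)
       (m : ℕ) {n : ℕ} (s r : Fin n → MetricSpace.Point M) (σ : Fin n → Fin n)
       (greedy : IsGreedy R M (suc (suc m)) s r σ) where
  open OrderedCommRing R
  open MetricSpace M
  open IsGreedy greedy
  open OrderedCommRingProperties R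
  open MetricSpaceProperties R M
  open import Relation.Binary.Reasoning.Base.Double isPreorder

  k : ℕ
  k = suc (suc m)

  on opt : Fin n → Carrier
  on  j = d (s (σ j)) (r j)
  opt j = d (r j) (s j)

  ON⁻ : ∀ {j} → ReqTree k σ j → Carrier
  ON⁻ (req st) = sumBy on (reqsS st)

  ON-root : ∀ {j} (T : ReqTree k σ j) → ON R M s r T ≈ on j + ON⁻ T
  ON-root (req st) = refl

  root∈reqs : ∀ {j} (T : ReqTree k σ j) → j ∈ reqs T
  root∈reqs (req st) = here ≡.refl

  LeavesUnused : ∀ {j} → ReqTree k σ j → Set
  LeavesUnused T = ∀ {j q} → j ∈ reqs T → q ∈ leaves T → Unused k σ q j

  record Walk {j} (T : ReqTree k σ j) : Set (c ⊔ ℓ₂) where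
    field
      len      : Carrier
      end      : Fin n
      end∈     : end ∈ leaves T
      d≤len    : d (s end) (r j) ≤ len
      budget   : m · ON⁻ T + k · len ≤ k · OPT R M s r T

  on≤len : ∀ {j} (T : ReqTree k σ j) → LeavesUnused T → (W : Walk T) → on j ≤ Walk.len W
  on≤len T unused W =
    ≤-trans (nearest _ end (unused (root∈reqs T) end∈)) d≤len
    where open Walk W

  walk : ∀ {j} (T : ReqTree k σ j) → LeavesUnused T → Walk T
  walk {j} (req leaf) _ = record
    { len = d (s j) (r j) ; end = j ; end∈ = here ≡.refl ; d≤len = ≤-refl
    ; budget = ≤-reflexive (begin-equality
        m · 0# + k · d (s j) (r j) ≈⟨ +-congʳ (·-zeroʳ m) ⟩
        0# + k · d (s j) (r j)     ≈⟨ +-identityˡ _ ⟩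
        k · d (s j) (r j)          ≈⟨ ·-cong k (trans (d-sym _ _) (sym (+-identityʳ _))) ⟩
        k · (opt j + 0#)           ∎) }
  walk {j} (req (branch ch ch↦j ts)) unused = record
    { len    = opt j + (on (ch t) + len t)
    ; end    = Walk.end (sub t)
    ; end∈   = ∈-concatMap-allFin (λ u → leaves (ts u)) t (Walk.end∈ (sub t))
    ; d≤len  = end-to-root
    ; budget = begin
        m · ON⁻ T + k · (opt j + (on (ch t) + len t))
          ≈⟨ +-congʳ (·-cong m ON⁻-branch) ⟩
        m · sumBy (λ u → on (ch u) + ON⁻ (ts u)) (allFin k) + k · (opt j + (on (ch t) + len t))
          ≲⟨ branch-budget m (allFin k) (λ u → on (ch u)) (λ u → ON⁻ (ts u)) len
               (λ u → OPT R M s r (ts u)) (opt j) t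
               (λ u → on≤len (ts u) (unused-sub u) (sub u)) len-min (λ u → Walk.budget (sub u)) ⟩
        k · (opt j + sumBy (λ u → OPT R M s r (ts u)) (allFin k))
          ≈⟨ ·-cong k (+-congˡ (sumBy-concatMap opt (λ u → reqs (ts u)) (allFin k))) ⟨
        k · OPT R M s r T ∎ }
    where
    T : ReqTree k σ j
    T = req (branch ch ch↦j ts)

    unused-sub : ∀ u → LeavesUnused (ts u)
    unused-sub u j∈ q∈ = unused (there (∈-concatMap-allFin (λ v → reqs (ts v)) u j∈))
                                (∈-concatMap-allFin (λ v → leaves (ts v)) u q∈)

    sub : ∀ u → Walk (ts u)
    sub u = walk (ts u) (unused-sub u)

    len : Fin k → Carrier
    len u = Walk.len (sub u)

    t : Fin k
    t = proj₁ (∃-·≤sumBy-allFin (suc m) len)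

    end-to-root : d (s (Walk.end (sub t))) (r j) ≤ opt j + (on (ch t) + len t)
    end-to-root rewrite ch↦j t = d-detour (Walk.d≤len (sub t))

    len-min : k · len t ≤ sumBy len (allFin k)
    len-min = proj₂ (∃-·≤sumBy-allFin (suc m) len)

    ON⁻-branch : ON⁻ T ≈ sumBy (λ u → on (ch u) + ON⁻ (ts u)) (allFin k)
    ON⁻-branch = trans (sumBy-concatMap on (λ u → reqs (ts u)) (allFin k))
                       (sumBy-cong (λ u → ON-root (ts u)) (allFin k))

  ON-bound : ∀ {i} (T : ReqTree k σ i) → LeavesUnused T → m · ON R M s r T ≤ k · OPT R M s r T
  ON-bound {i} T unused = begin
    m · ON R M s r T      ≈⟨ ·-cong m (ON-root T) ⟩
    m · (on i + ON⁻ T)    ≈⟨ ·-distribˡ m ⟩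
    m · on i + m · ON⁻ T  ≲⟨ +-mono-≤ (m · ON⁻ T) (≤-trans (·-monoʳ-≤ m (on≤len T unused W)) m·len≤k·len) ⟩
    k · len + m · ON⁻ T   ≈⟨ +-comm _ _ ⟩
    m · ON⁻ T + k · len   ≲⟨ budget ⟩
    k · OPT R M s r T     ∎
    where
    W = walk T unused
    open Walk W
    m·len≤k·len : m · len ≤ k · len
    m·len≤k·len = ·-monoˡ-≤ (m≤n+m m 2) (≤-trans (d-nonneg _ _) d≤len)

lemma5 : ∀ {c ℓ₁ ℓ₂ a} (R : OrderedCommRing c ℓ₁ ℓ₂) (M : MetricSpace R a)
    (k : ℕ) → 3 ≤ℕ k →
    {n : ℕ} (s r : Fin n → MetricSpace.Point M) (σ : Fin n → Fin n) →
    IsGreedy R M k s r σ →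
    (i : Fin n) (T : ReqTree k σ i) →
    Unique (reqs T) →
    (∀ {j} → j ∈ reqs T → j ≤ᶠ i) →
    (∀ {j q} → j ∈ reqs T → q ∈ leaves T → Unused k σ q j) →
    OrderedCommRing._≤_ R
    (OrderedCommRing._·_ R (k ∸ 2) (ON R M s r T))
    (OrderedCommRing._·_ R k (OPT R M s r T))
lemma5 R M _ (s≤s (s≤s {n = m} _)) s r σ greedy i T _ _ unused =
  ResponseTreeBound.ON-bound R M m s r σ greedy T unused
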